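{- Let $X$ be a finite connected pure $2$-dimensional simplicial complex with vertex set $V$, and let $W$ be the set of edges of $X$, regarded as the vertex set of the embedded graph of $X$. Let $\delta_{min}=\min_{v\in V}\delta(v)$, where $\delta(v)$ is the number of edges of $X$ containing $v$. Assume that a nonempty proper subset $A$ of $V$ attains the minimum \[H(X)=\min_{0 < |A|<|V|} \frac{|V|\cdot |F(A,V\setminus A)|}{|A|\cdot |V\setminus A|}.\] Then there exists a subset $B$ of $W$ with $0<|B|<|W|$ such that \[ \frac{|E(B,W\setminus B)|}{2}\leq |F(A,V\setminus A)| ,\qquad |A|\leq |B| ,\qquad |V\setminus A|\leq \frac{2| W \setminus B|}{\delta_{min}}.\]
   Context: A simplicial complex is pure if all its inclusion-maximal faces have the same dimension. For $A\subset V$, $F(A,V\setminus A)$ denotes the set of $2$-faces of $X$ containing at least one vertex of $A$ and at least one vertex of $V\setminus A$; the minimum is over nonempty proper subsets $A$ of $V$. The embedded graph of $X$ is the graph whose vertices are the edges ($1$-faces) of $X$, two distinct edges of $X$ being adjacent if and only if they are both contained in a common $2$-face of $X$. For $B\subset W$, $E(B,W\setminus B)$ is the set of edges of the embedded graph with one endpoint in $B$ and the other in $W\setminus B$. -}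

module Defs where

open import Data.Bool using (Bool; true; false; _∧_; not)
open import Data.Nat using (ℕ; zero; suc; _⊓_; _≡ᵇ_)
open import Data.List using (List; []; _∷_; _++_; map; filter; length; foldr)
open import Data.Bool.ListAction using (any)
open import Data.Fin using (Fin)
open import Data.Fin.Subset using (Subset; _⊆_; ⁅_⁆; ∣_∣; ∁; _∩_; Nonempty; _∈_)
open import Data.Fin.Subset.Properties using (_⊆?_; nonempty?; _∈?_)
open import Data.Vec using ([]; _∷_)
open import Data.Fin.Base using (zero; suc)
open import Data.List using (allFin)
open import Relation.Nullary.Decidable using (⌊_⌋)
open import Relation.Binary.PropositionalEquality using (_≡_)
import Data.Product
import Data.Vec.Properties
import Data.Nat
import Data.Bool
import Data.Fin.Subset

allSubsets : (n : ℕ) → List (Subset n)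
allSubsets zero = [] ∷ []
allSubsets (suc n) = map (true ∷_) (allSubsets n) ++ map (false ∷_) (allSubsets n)

countSubsets : {n : ℕ} → (Subset n → Bool) → ℕ
countSubsets {n} P = length (filter (λ s → P s Data.Bool.≟ true) (allSubsets n))

countPairs : {n : ℕ} → (Subset n → Subset n → Bool) → ℕ
countPairs {n} P = foldr (λ s acc → countSubsets (P s) Data.Nat.+ acc) 0 (allSubsets n)

-- A finite abstract simplicial complex with vertex set V = Fin n:
-- a (decidable) family of faces, closed under taking subsets, containing
-- every singleton {v} (so every element of Fin n is a vertex).
record SimplicialComplex (n : ℕ) : Set where
  field
    face      : Subset n → Bool
    downClosed : ∀ s t → s ⊆ t → face t ≡ true → face s ≡ true
    vertices  : ∀ v → face ⁅ v ⁆ ≡ true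

module _ {n : ℕ} (X : SimplicialComplex n) where
  open SimplicialComplex X

  isEdge : Subset n → Bool
  isEdge s = face s ∧ (∣ s ∣ ≡ᵇ 2)

  isTriangle : Subset n → Bool
  isTriangle s = face s ∧ (∣ s ∣ ≡ᵇ 3)

  -- dim s = |s| - 1 ; face s has dimension k iff |s| = k + 1
  -- pure 2-dimensional: every face lies in a 2-face and there is no face of
  -- dimension ≥ 3 (so all maximal faces are 2-faces); X has a 2-face.
  record Pure2Dim : Set where
    field
      noBig     : ∀ s → face s ≡ true → Data.Nat._≤_ ∣ s ∣ 3
      inTriangle : ∀ s → face s ≡ true →
                   Data.Product.Σ (Subset n) (λ t → isTriangle t ≡ true Data.Product.× s ⊆ t)
      hasTriangle : Data.Product.Σ (Subset n) (λ t → isTriangle t ≡ true)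

  data Reachable : Fin n → Fin n → Set where
    here : ∀ {v} → Reachable v v
    step : ∀ {u v w} → isEdge (⁅ u ⁆ Data.Fin.Subset.∪ ⁅ v ⁆) ≡ true → Reachable v w → Reachable u w

  Connected : Set
  Connected = ∀ u v → Reachable u v

  deg : Fin n → ℕ
  deg v = countSubsets (λ s → isEdge s ∧ ⌊ v ∈? s ⌋)

  numEdges : ℕ
  numEdges = countSubsets isEdge

  -- δ_min = min_v δ(v)  (for n ≥ 1; numEdges ≥ every δ(v) is only the fold seed)
  deltaMin : ℕ
  deltaMin = foldr _⊓_ numEdges (map deg (allFin n))

  -- |F(A, V∖A)|: 2-faces meeting both A and V∖A
  crossF : Subset n → ℕ
  crossF A = countSubsets (λ s → isTriangle s ∧ ⌊ nonempty? (s ∩ A) ⌋ ∧ ⌊ nonempty? (s ∩ ∁ A) ⌋)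

  -- adjacency in the embedded graph: distinct edges lying in a common 2-face
  adjacent : Subset n → Subset n → Bool
  adjacent e f = isEdge e ∧ isEdge f ∧ not ⌊ Data.Vec.Properties.≡-dec Data.Bool._≟_ e f ⌋
                 ∧ any (λ t → isTriangle t ∧ ⌊ e ⊆? t ⌋ ∧ ⌊ f ⊆? t ⌋) (allSubsets n)

  -- a subset B of W is a Boolean predicate on subsets of Fin n contained in W
  -- |B| and |W∖B|
  sizeB : (Subset n → Bool) → ℕ
  sizeB B = countSubsets (λ s → isEdge s ∧ B s)

  sizeWminusB : (Subset n → Bool) → ℕ
  sizeWminusB B = countSubsets (λ s → isEdge s ∧ not (B s))

  -- |E(B, W∖B)|: each embedded-graph edge {e,f} with e ∈ B, f ∈ W∖B counted once
  crossE : (Subset n → Bool) → ℕ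
  crossE B = countPairs (λ e f → adjacent e f ∧ B e ∧ not (B f))

{-# OPTIONS --safe #-}
module Submission where

-- Write e₂, e₁, e₀ for the numbers of edges with two, one and no vertices in A.
-- Every vertex lies in a 2-face, hence on at least two edges, so δ_min ≥ 2, and
-- double counting vertex-edge incidences gives |A| δ_min ≤ 2 e₂ + e₁ and
-- |V∖A| δ_min ≤ 2 e₀ + e₁.  Let B consist of the edges inside A together with
-- s = |A| − e₂ crossing edges; the first inequality gives 2 s ≤ e₁, whence
-- |B| = e₂ + s ≥ |A| and 2 |W∖B| = 2 (e₁ − s + e₀) ≥ 2 e₀ + e₁ ≥ |V∖A| δ_min.
-- Every edge of B meets A and every other edge meets V∖A, so an edge of the
-- embedded graph from B to W∖B lies in a 2-face crossing (A, V∖A); the three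
-- edges of that 2-face split as k + (3 − k) between B and W∖B, so it carries at
-- most k (3 − k) ≤ 2 such edges.

open import Defs
open import Algebra.Properties.CommutativeSemigroup using (interchange)
open import Data.Bool using (Bool; true; false; _∧_; _∨_; not; T)
open import Data.Bool.ListAction using (any)
open import Data.Bool.Properties
  using (∧-zeroʳ; ∧-identityʳ; ∧-conicalˡ; ∧-conicalʳ; ∨-conicalˡ; not-involutive; T-≡)
import Data.Fin as Fin
open import Data.Fin using (Fin)
open import Data.Fin.Subset using (Subset; _⊆_; ∣_∣; ∁; _∩_; ⊥; ⁅_⁆; Nonempty)
open import Data.Fin.Subset.Properties
  using (_⊆?_; _∈?_; nonempty?; drop-∷-⊆; p⊆q⇒∣p∣≤∣q∣; ⊥⊆; ∣⊥∣≡0; ∣⁅x⁆∣≡1; x∈⁅x⁆;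
         Empty-unique; x∈p∩q⁺; x∈p∩q⁻; ∣∁p∣≡n∸∣p∣)
open import Data.List using (List; []; _∷_; _++_; map; filter; length; foldr; tabulate; allFin)
open import Data.List.Membership.Propositional.Properties using (∈-map⁺; ∈-allFin)
open import Data.List.Properties using (map-tabulate)
open import Data.List.Relation.Unary.All as All using (All; []; _∷_)
import Data.List.Relation.Unary.All.Properties as All
open import Data.Nat using (ℕ; zero; suc; _+_; _*_; _∸_; _≤_; _<_; _⊓_; _≡ᵇ_; z≤n; s≤s; z<s; _≤?_)
open import Data.Nat.Combinatorics using (_C_; nCk+nC[k+1]≡[n+1]C[k+1])
open import Data.Nat.Properties
open import Data.Nat.Tactic.RingSolver using (solve-∀)
open import Data.Product using (Σ; Σ-syntax; _×_; _,_; proj₁; proj₂)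
open import Data.Vec using ([]; _∷_; lookup; here)
open import Data.Vec.Properties using (lookup-zipWith)
open import Function using (id; _∘_; Equivalence)
open import Relation.Binary.PropositionalEquality
open import Relation.Nullary using (Dec; does; yes; no; contradiction)
open import Relation.Nullary.Decidable using (⌊_⌋; isYes≗does; dec-true; dec-false)

⟦_⟧ : Bool → ℕ
⟦ true ⟧  = 1
⟦ false ⟧ = 0

_⇒ᵇ_ : {A : Set} → (A → Bool) → (A → Bool) → Set
P ⇒ᵇ Q = ∀ x → P x ≡ true → Q x ≡ true

⟦⟧-mono : ∀ {a b} → (a ≡ true → b ≡ true) → ⟦ a ⟧ ≤ ⟦ b ⟧
⟦⟧-mono {false} a⇒b = z≤n
⟦⟧-mono {true}  a⇒b rewrite a⇒b refl = ≤-refl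

⟦∧⟧ : ∀ a b → ⟦ a ∧ b ⟧ ≡ ⟦ a ⟧ * ⟦ b ⟧
⟦∧⟧ false b = refl
⟦∧⟧ true  b = sym (+-identityʳ ⟦ b ⟧)

⟦∧⟧+⟦∧not⟧ : ∀ a b → ⟦ a ∧ b ⟧ + ⟦ a ∧ not b ⟧ ≡ ⟦ a ⟧
⟦∧⟧+⟦∧not⟧ false b     = refl
⟦∧⟧+⟦∧not⟧ true  true  = refl
⟦∧⟧+⟦∧not⟧ true  false = refl

⟦∨⟧ : ∀ a b → (a ≡ true → b ≡ false) → ⟦ a ∨ b ⟧ ≡ ⟦ a ⟧ + ⟦ b ⟧
⟦∨⟧ false b     _        = refl
⟦∨⟧ true  false _        = refl
⟦∨⟧ true  true  a⇒¬b with a⇒¬b refl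
... | ()

⟦∧⟧-⇒ : ∀ a b → (b ≡ true → a ≡ true) → ⟦ a ∧ b ⟧ ≡ ⟦ b ⟧
⟦∧⟧-⇒ a     false _   = cong ⟦_⟧ (∧-zeroʳ a)
⟦∧⟧-⇒ a     true  b⇒a rewrite b⇒a refl = refl

true≡ᵇ⇒≡ : ∀ m n → (m ≡ᵇ n) ≡ true → m ≡ n
true≡ᵇ⇒≡ m n eq = ≡ᵇ⇒≡ m n (Equivalence.from T-≡ eq)

false≡ᵇ⇒≢ : ∀ {m n} → (m ≡ᵇ n) ≡ false → m ≢ n
false≡ᵇ⇒≢ {m} m≡ᵇm≡false refl = subst T m≡ᵇm≡false (≡⇒≡ᵇ m m refl)

does-sound : {P : Set} (d : Dec P) → does d ≡ true → P
does-sound (yes p) _ = p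

isYes⇒does : {P : Set} (d : Dec P) → ⌊ d ⌋ ≡ true → does d ≡ true
isYes⇒does d = trans (sym (isYes≗does d))

∑ : {A : Set} → List A → (A → ℕ) → ℕ
∑ []       f = 0
∑ (x ∷ xs) f = f x + ∑ xs f

syntax ∑ L (λ x → e) = ∑[ x ∈ L ] e

module _ {A : Set} where

  ∑-cong : (L : List A) {f g : A → ℕ} → (∀ x → f x ≡ g x) → ∑ L f ≡ ∑ L g
  ∑-cong []       f≗g = refl
  ∑-cong (x ∷ L) f≗g = cong₂ _+_ (f≗g x) (∑-cong L f≗g)

  ∑-mono-≤ : (L : List A) {f g : A → ℕ} → (∀ x → f x ≤ g x) → ∑ L f ≤ ∑ L g
  ∑-mono-≤ []       f≤g = z≤n
  ∑-mono-≤ (x ∷ L) f≤g = +-mono-≤ (f≤g x) (∑-mono-≤ L f≤g)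

  ∑-zero : (L : List A) → ∑[ x ∈ L ] 0 ≡ 0
  ∑-zero []       = refl
  ∑-zero (x ∷ L) = ∑-zero L

  ∑-distrib-+ : (L : List A) (f g : A → ℕ) → ∑[ x ∈ L ] (f x + g x) ≡ ∑ L f + ∑ L g
  ∑-distrib-+ []       f g = refl
  ∑-distrib-+ (x ∷ L) f g =
    trans (cong (f x + g x +_) (∑-distrib-+ L f g)) (interchange +-commutativeSemigroup (f x) (g x) (∑ L f) (∑ L g))

  ∑-distribˡ-* : (L : List A) (c : ℕ) (f : A → ℕ) → ∑[ x ∈ L ] (c * f x) ≡ c * ∑ L f
  ∑-distribˡ-* []       c f = sym (*-zeroʳ c)
  ∑-distribˡ-* (x ∷ L) c f = trans (cong (c * f x +_) (∑-distribˡ-* L c f)) (sym (*-distribˡ-+ c (f x) _))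

  ∑-++ : (L M : List A) (f : A → ℕ) → ∑ (L ++ M) f ≡ ∑ L f + ∑ M f
  ∑-++ []       M f = refl
  ∑-++ (x ∷ L) M f = trans (cong (f x +_) (∑-++ L M f)) (sym (+-assoc (f x) _ _))

  ∑*∑ : (L : List A) (f g : A → ℕ) → ∑[ x ∈ L ] ∑[ y ∈ L ] (f x * g y) ≡ ∑ L f * ∑ L g
  ∑*∑ L f g = begin
    ∑[ x ∈ L ] ∑[ y ∈ L ] (f x * g y) ≡⟨ ∑-cong L (λ x → ∑-distribˡ-* L (f x) g) ⟩
    ∑[ x ∈ L ] (f x * ∑ L g)          ≡⟨ ∑-cong L (λ x → *-comm (f x) (∑ L g)) ⟩
    ∑[ x ∈ L ] (∑ L g * f x)          ≡⟨ ∑-distribˡ-* L (∑ L g) f ⟩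
    ∑ L g * ∑ L f                     ≡⟨ *-comm (∑ L g) _ ⟩
    ∑ L f * ∑ L g                     ∎
    where open ≡-Reasoning

  any⇒1≤∑ : (L : List A) (p : A → Bool) (f : A → ℕ) →
            any p L ≡ true → (∀ x → p x ≡ true → 1 ≤ f x) → 1 ≤ ∑ L f
  any⇒1≤∑ (x ∷ L) p f any≡true p⇒1≤f with p x in px
  ... | true  = ≤-trans (p⇒1≤f x px) (m≤m+n (f x) _)
  ... | false = ≤-trans (any⇒1≤∑ L p f any≡true p⇒1≤f) (m≤n+m _ (f x))

  ∑-2*+ : (L : List A) {f g h : A → ℕ} → (∀ x → f x ≡ 2 * g x + h x) → ∑ L f ≡ 2 * ∑ L g + ∑ L h
  ∑-2*+ L {f} {g} {h} f≗2g+h =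
    trans (∑-cong L f≗2g+h) (trans (∑-distrib-+ L (λ x → 2 * g x) h) (cong (_+ ∑ L h) (∑-distribˡ-* L 2 g)))

∑-map : {A B : Set} (L : List A) (g : A → B) (f : B → ℕ) → ∑ (map g L) f ≡ ∑[ x ∈ L ] f (g x)
∑-map []       g f = refl
∑-map (x ∷ L) g f = cong (f (g x) +_) (∑-map L g f)

∑-comm : {A B : Set} (L : List A) (M : List B) (f : A → B → ℕ) →
         ∑[ x ∈ L ] ∑[ y ∈ M ] f x y ≡ ∑[ y ∈ M ] ∑[ x ∈ L ] f x y
∑-comm []       M f = sym (∑-zero M)
∑-comm (x ∷ L) M f = trans (cong (∑ M (f x) +_) (∑-comm L M f))
                            (sym (∑-distrib-+ M (f x) (λ y → ∑[ x ∈ L ] f x y)))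

∑-allSubsets-suc : (n : ℕ) (f : Subset (suc n) → ℕ) →
  ∑ (allSubsets (suc n)) f ≡ ∑[ s ∈ allSubsets n ] f (true ∷ s) + ∑[ s ∈ allSubsets n ] f (false ∷ s)
∑-allSubsets-suc n f = trans (∑-++ (map (true ∷_) (allSubsets n)) _ f)
  (cong₂ _+_ (∑-map (allSubsets n) (true ∷_) f) (∑-map (allSubsets n) (false ∷_) f))

length-filter≡∑ : {A : Set} (L : List A) (P : A → Bool) →
  length (filter (λ s → P s Data.Bool.≟ true) L) ≡ ∑[ x ∈ L ] ⟦ P x ⟧
length-filter≡∑ []       P = refl
length-filter≡∑ (x ∷ L) P with P x
... | true  = cong suc (length-filter≡∑ L P)
... | false = length-filter≡∑ L P

countSubsets≡∑ : {n : ℕ} (P : Subset n → Bool) → countSubsets P ≡ ∑[ s ∈ allSubsets n ] ⟦ P s ⟧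
countSubsets≡∑ {n} = length-filter≡∑ (allSubsets n)

countPairs≡∑∑ : {n : ℕ} (P : Subset n → Subset n → Bool) →
  countPairs P ≡ ∑[ s ∈ allSubsets n ] ∑[ t ∈ allSubsets n ] ⟦ P s t ⟧
countPairs≡∑∑ {n} P = go (allSubsets n)
  where
  go : (L : List (Subset n)) →
       foldr (λ s acc → countSubsets (P s) + acc) 0 L ≡ ∑[ s ∈ L ] ∑[ t ∈ allSubsets n ] ⟦ P s t ⟧
  go []       = refl
  go (s ∷ L) = cong₂ _+_ (countSubsets≡∑ (P s)) (go L)

-- Stated with `does` rather than ⌊_⌋: `does (u ⊆? e)` computes on cons cells,
-- ⌊ u ⊆? e ⌋ does not.
between : ∀ {n} → Subset n → Subset n → ℕ → Subset n → Bool
between u t k e = does (u ⊆? e) ∧ does (e ⊆? t) ∧ (∣ e ∣ ≡ᵇ k + ∣ u ∣)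

∑-between : ∀ {n} (u t : Subset n) → u ⊆ t → ∀ m k → ∣ t ∣ ≡ m + ∣ u ∣ →
  ∑[ e ∈ allSubsets n ] ⟦ between u t k e ⟧ ≡ m C k
∑-between []          []          _   zero    zero    _ = refl
∑-between []          []          _   zero    (suc k) _ = refl
∑-between {suc n} (true ∷ u) (true ∷ t) u⊆t m k ∣t∣≡m+∣u∣ = begin
  ∑[ e ∈ allSubsets (suc n) ] ⟦ between (true ∷ u) (true ∷ t) k e ⟧
    ≡⟨ ∑-allSubsets-suc n (⟦_⟧ ∘ between (true ∷ u) (true ∷ t) k) ⟩
  ∑[ e ∈ W ] ⟦ does (u ⊆? e) ∧ does (e ⊆? t) ∧ (suc ∣ e ∣ ≡ᵇ k + suc ∣ u ∣) ⟧ + ∑[ e ∈ W ] 0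
    ≡⟨ cong₂ _+_ (∑-cong W (λ e → cong (λ j → ⟦ does (u ⊆? e) ∧ does (e ⊆? t) ∧ (suc ∣ e ∣ ≡ᵇ j) ⟧)
                                       (+-suc k ∣ u ∣)))
                 (∑-zero W) ⟩
  ∑[ e ∈ W ] ⟦ between u t k e ⟧ + 0
    ≡⟨ +-identityʳ _ ⟩
  ∑[ e ∈ W ] ⟦ between u t k e ⟧
    ≡⟨ ∑-between u t (drop-∷-⊆ u⊆t) m k (suc-injective (trans ∣t∣≡m+∣u∣ (+-suc m ∣ u ∣))) ⟩
  m C k ∎
  where
  open ≡-Reasoning
  W = allSubsets n
∑-between {suc n} (false ∷ u) (true ∷ t) u⊆t zero k ∣t∣≡∣u∣ =
  contradiction (≤-reflexive ∣t∣≡∣u∣) (<⇒≱ (s≤s (p⊆q⇒∣p∣≤∣q∣ (drop-∷-⊆ u⊆t))))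
∑-between {suc n} (false ∷ u) (true ∷ t) u⊆t (suc m) zero ∣t∣≡m+∣u∣ = begin
  ∑[ e ∈ allSubsets (suc n) ] ⟦ between (false ∷ u) (true ∷ t) 0 e ⟧
    ≡⟨ ∑-allSubsets-suc n (⟦_⟧ ∘ between (false ∷ u) (true ∷ t) 0) ⟩
  ∑[ e ∈ W ] ⟦ does (u ⊆? e) ∧ does (e ⊆? t) ∧ (suc ∣ e ∣ ≡ᵇ ∣ u ∣) ⟧ + ∑[ e ∈ W ] ⟦ between u t 0 e ⟧
    ≡⟨ cong (_+ ∑[ e ∈ W ] ⟦ between u t 0 e ⟧) (trans (∑-cong W 1+∣e∣≢∣u∣) (∑-zero W)) ⟩
  ∑[ e ∈ W ] ⟦ between u t 0 e ⟧
    ≡⟨ ∑-between u t (drop-∷-⊆ u⊆t) m 0 (suc-injective ∣t∣≡m+∣u∣) ⟩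
  1 ∎
  where
  open ≡-Reasoning
  W = allSubsets n
  1+∣e∣≢∣u∣ : ∀ e → ⟦ does (u ⊆? e) ∧ does (e ⊆? t) ∧ (suc ∣ e ∣ ≡ᵇ ∣ u ∣) ⟧ ≡ 0
  1+∣e∣≢∣u∣ e with u ⊆? e
  ... | no _    = refl
  ... | yes u⊆e rewrite dec-false (suc ∣ e ∣ ≟ ∣ u ∣) (<⇒≢ (s≤s (p⊆q⇒∣p∣≤∣q∣ u⊆e)) ∘ sym) =
    cong ⟦_⟧ (∧-zeroʳ (does (e ⊆? t)))
∑-between {suc n} (false ∷ u) (true ∷ t) u⊆t (suc m) (suc k) ∣t∣≡m+∣u∣ = begin
  ∑[ e ∈ allSubsets (suc n) ] ⟦ between (false ∷ u) (true ∷ t) (suc k) e ⟧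
    ≡⟨ ∑-allSubsets-suc n (⟦_⟧ ∘ between (false ∷ u) (true ∷ t) (suc k)) ⟩
  ∑[ e ∈ W ] ⟦ between u t k e ⟧ + ∑[ e ∈ W ] ⟦ between u t (suc k) e ⟧
    ≡⟨ cong₂ _+_ (∑-between u t u⊆t′ m k ∣t∣≡) (∑-between u t u⊆t′ m (suc k) ∣t∣≡) ⟩
  m C k + m C suc k
    ≡⟨ nCk+nC[k+1]≡[n+1]C[k+1] m k ⟩
  suc m C suc k ∎
  where
  open ≡-Reasoning
  W = allSubsets n
  u⊆t′ = drop-∷-⊆ u⊆t
  ∣t∣≡ = suc-injective ∣t∣≡m+∣u∣
∑-between {suc n} (false ∷ u) (false ∷ t) u⊆t m k ∣t∣≡m+∣u∣ = begin
  ∑[ e ∈ allSubsets (suc n) ] ⟦ between (false ∷ u) (false ∷ t) k e ⟧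
    ≡⟨ ∑-allSubsets-suc n (⟦_⟧ ∘ between (false ∷ u) (false ∷ t) k) ⟩
  ∑[ e ∈ W ] ⟦ does (u ⊆? e) ∧ false ⟧ + ∑[ e ∈ W ] ⟦ between u t k e ⟧
    ≡⟨ cong (_+ ∑[ e ∈ W ] ⟦ between u t k e ⟧)
            (trans (∑-cong W (λ e → cong ⟦_⟧ (∧-zeroʳ (does (u ⊆? e))))) (∑-zero W)) ⟩
  ∑[ e ∈ W ] ⟦ between u t k e ⟧
    ≡⟨ ∑-between u t (drop-∷-⊆ u⊆t) m k ∣t∣≡m+∣u∣ ⟩
  m C k ∎
  where
  open ≡-Reasoning
  W = allSubsets n
∑-between (true ∷ u) (false ∷ t) u⊆t m k _ with u⊆t here
... | ()

module _ {n : ℕ} where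

  _⊕_ : (Subset n → Bool) → (Subset n → Bool) → Subset (suc n) → Bool
  (P ⊕ Q) (true  ∷ s) = P s
  (P ⊕ Q) (false ∷ s) = Q s

  ⊕-⇒ᵇ : ∀ {P Q} {R : Subset (suc n) → Bool} →
         P ⇒ᵇ (R ∘ (true ∷_)) → Q ⇒ᵇ (R ∘ (false ∷_)) → (P ⊕ Q) ⇒ᵇ R
  ⊕-⇒ᵇ P⇒R Q⇒R (true  ∷ s) = P⇒R s
  ⊕-⇒ᵇ P⇒R Q⇒R (false ∷ s) = Q⇒R s

choose : ∀ n (P : Subset n → Bool) k → k ≤ ∑[ s ∈ allSubsets n ] ⟦ P s ⟧ →
         Σ[ Q ∈ (Subset n → Bool) ] Q ⇒ᵇ P × ∑[ s ∈ allSubsets n ] ⟦ Q s ⟧ ≡ k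
choose n P zero _ = (λ _ → false) , (λ _ ()) , ∑-zero (allSubsets n)
choose zero P (suc k) 1+k≤ with P [] in P[]≡true
... | true  = (λ _ → true) , (λ { [] _ → P[]≡true }) , cong suc (sym (n≤0⇒n≡0 (≤-pred 1+k≤)))
choose zero P (suc k) () | false
choose (suc n) P k k≤ with k ≤? ∑[ s ∈ allSubsets n ] ⟦ P (true ∷ s) ⟧
... | yes k≤c =
  let (Q , Q⇒P , ∑Q≡k) = choose n (P ∘ (true ∷_)) k k≤c
  in Q ⊕ (λ _ → false) , ⊕-⇒ᵇ Q⇒P (λ _ ()) ,
     trans (∑-allSubsets-suc n (⟦_⟧ ∘ (Q ⊕ λ _ → false)))
           (trans (cong₂ _+_ ∑Q≡k (∑-zero (allSubsets n))) (+-identityʳ k))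
... | no k≰c =
  let c = ∑[ s ∈ allSubsets n ] ⟦ P (true ∷ s) ⟧
      k∸c≤ = m≤n+o⇒m∸n≤o k c (subst (k ≤_) (∑-allSubsets-suc n (⟦_⟧ ∘ P)) k≤)
      (Q , Q⇒P , ∑Q≡k∸c) = choose n (P ∘ (false ∷_)) (k ∸ c) k∸c≤
  in (P ∘ (true ∷_)) ⊕ Q , ⊕-⇒ᵇ (λ _ → id) Q⇒P ,
     trans (∑-allSubsets-suc n (⟦_⟧ ∘ ((P ∘ (true ∷_)) ⊕ Q)))
           (trans (cong (c +_) ∑Q≡k∸c) (m+[n∸m]≡n (<⇒≤ (≰⇒> k≰c))))

∣p∣≡∑lookup : ∀ {n} (p : Subset n) → ∣ p ∣ ≡ ∑[ v ∈ allFin n ] ⟦ lookup p v ⟧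
∣p∣≡∑lookup {zero}  []      = refl
∣p∣≡∑lookup {suc n} (b ∷ p) = trans (∣x∷p∣ b) (cong (⟦ b ⟧ +_) (begin
    ∣ p ∣
      ≡⟨ ∣p∣≡∑lookup p ⟩
    ∑[ v ∈ allFin n ] ⟦ lookup p v ⟧
      ≡⟨ ∑-map (allFin n) Fin.suc (λ v → ⟦ lookup (b ∷ p) v ⟧) ⟨
    ∑[ v ∈ map Fin.suc (allFin n) ] ⟦ lookup (b ∷ p) v ⟧
      ≡⟨ cong (λ vs → ∑[ v ∈ vs ] ⟦ lookup (b ∷ p) v ⟧) (map-tabulate id Fin.suc) ⟩
    ∑[ v ∈ tabulate Fin.suc ] ⟦ lookup (b ∷ p) v ⟧ ∎))
  where
  open ≡-Reasoning
  ∣x∷p∣ : ∀ x → ∣ x ∷ p ∣ ≡ ⟦ x ⟧ + ∣ p ∣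
  ∣x∷p∣ true  = refl
  ∣x∷p∣ false = refl

∣p∩q∣+∣p∩∁q∣≡∣p∣ : ∀ {n} (p q : Subset n) → ∣ p ∩ q ∣ + ∣ p ∩ ∁ q ∣ ≡ ∣ p ∣
∣p∩q∣+∣p∩∁q∣≡∣p∣ []          []          = refl
∣p∩q∣+∣p∩∁q∣≡∣p∣ (true  ∷ p) (true  ∷ q) = cong suc (∣p∩q∣+∣p∩∁q∣≡∣p∣ p q)
∣p∩q∣+∣p∩∁q∣≡∣p∣ (true  ∷ p) (false ∷ q) = trans (+-suc _ _) (cong suc (∣p∩q∣+∣p∩∁q∣≡∣p∣ p q))
∣p∩q∣+∣p∩∁q∣≡∣p∣ (false ∷ p) (_     ∷ q) = ∣p∩q∣+∣p∩∁q∣≡∣p∣ p q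

0<∣p∣⇒Nonempty : ∀ {n} {p : Subset n} → 0 < ∣ p ∣ → Nonempty p
0<∣p∣⇒Nonempty {n} {p} 0<∣p∣ with nonempty? p
... | yes ne = ne
... | no  ¬ne = contradiction (trans (cong ∣_∣ (Empty-unique ¬ne)) (∣⊥∣≡0 n)) (>⇒≢ 0<∣p∣)

Nonempty-∩-⊆ : ∀ {n} {p q : Subset n} r → p ⊆ q → Nonempty (p ∩ r) → Nonempty (q ∩ r)
Nonempty-∩-⊆ {p = p} r p⊆q (x , x∈p∩r) =
  let x∈p , x∈r = x∈p∩q⁻ p r x∈p∩r in x , x∈p∩q⁺ (p⊆q x∈p , x∈r)

does-∈?≡lookup : ∀ {n} (v : Fin n) (p : Subset n) → does (v ∈? p) ≡ lookup p v
does-∈?≡lookup Fin.zero    (true  ∷ p) = refl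
does-∈?≡lookup Fin.zero    (false ∷ p) = refl
does-∈?≡lookup (Fin.suc v) (_     ∷ p) = does-∈?≡lookup v p

foldr-⊓-lower : ∀ seed (xs : List ℕ) → All (foldr _⊓_ seed xs ≤_) xs
foldr-⊓-lower seed []       = []
foldr-⊓-lower seed (x ∷ xs) = m⊓n≤m x _ ∷ All.map (≤-trans (m⊓n≤n x _)) (foldr-⊓-lower seed xs)

foldr-⊓-greatest : ∀ {c} seed (xs : List ℕ) → c ≤ seed → All (c ≤_) xs → c ≤ foldr _⊓_ seed xs
foldr-⊓-greatest seed []       c≤seed []            = c≤seed
foldr-⊓-greatest seed (x ∷ xs) c≤seed (c≤x ∷ c≤xs) = ⊓-glb c≤x (foldr-⊓-greatest seed xs c≤seed c≤xs)

-- The factor 1 matches ⟦ isEdge X e ⟧ * ∣ e ∩ A ∣ at an edge e.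
a+c≡2⇒indicators : ∀ a c → a + c ≡ 2 →
  (1 * a ≡ 2 * ⟦ a ≡ᵇ 2 ⟧ + ⟦ a ≡ᵇ 1 ⟧) × (1 * c ≡ 2 * ⟦ a ≡ᵇ 0 ⟧ + ⟦ a ≡ᵇ 1 ⟧) ×
  (1 ≡ ⟦ a ≡ᵇ 2 ⟧ + ⟦ a ≡ᵇ 1 ⟧ + ⟦ a ≡ᵇ 0 ⟧)
a+c≡2⇒indicators 0 .2 refl = refl , refl , refl
a+c≡2⇒indicators 1 .1 refl = refl , refl , refl
a+c≡2⇒indicators 2 .0 refl = refl , refl , refl

m+n≡3⇒m*n≤2 : ∀ m n → m + n ≡ 3 → m * n ≤ 2
m+n≡3⇒m*n≤2 0 n _    = z≤n
m+n≡3⇒m*n≤2 1 .2 refl = ≤-refl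
m+n≡3⇒m*n≤2 2 .1 refl = ≤-refl
m+n≡3⇒m*n≤2 3 .0 refl = z≤n

2*[m∸n]≤o : ∀ m n o → 2 * m ≤ 2 * n + o → 2 * (m ∸ n) ≤ o
2*[m∸n]≤o m n o 2m≤2n+o = subst (_≤ o) (sym (*-distribˡ-∸ 2 m n)) (m≤n+o⇒m∸n≤o (2 * m) (2 * n) 2m≤2n+o)

c+[2d+c]≡2[c+d] : ∀ c d → c + (2 * d + c) ≡ 2 * (c + d)
c+[2d+c]≡2[c+d] = solve-∀

2*s≤c⇒2*d+c≤2*w : ∀ s w c d → 2 * s ≤ c → s + w ≡ c + d → 2 * d + c ≤ 2 * w
2*s≤c⇒2*d+c≤2*w s w c d 2s≤c s+w≡c+d = +-cancelˡ-≤ (2 * s) _ _ (begin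
  2 * s + (2 * d + c) ≤⟨ +-monoˡ-≤ (2 * d + c) 2s≤c ⟩
  c + (2 * d + c)     ≡⟨ c+[2d+c]≡2[c+d] c d ⟩
  2 * (c + d)         ≡⟨ cong (2 *_) s+w≡c+d ⟨
  2 * (s + w)         ≡⟨ *-distribˡ-+ 2 s w ⟩
  2 * s + 2 * w       ∎)
  where open ≤-Reasoning

module _ {n : ℕ} (X : SimplicialComplex n) where
  open SimplicialComplex X

  isEdge⇒∣e∣≡2 : ∀ {e} → isEdge X e ≡ true → ∣ e ∣ ≡ 2
  isEdge⇒∣e∣≡2 {e} h = true≡ᵇ⇒≡ ∣ e ∣ 2 (∧-conicalʳ (face e) _ h)

  isTriangle⇒∣t∣≡3 : ∀ {t} → isTriangle X t ≡ true → ∣ t ∣ ≡ 3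
  isTriangle⇒∣t∣≡3 {t} h = true≡ᵇ⇒≡ ∣ t ∣ 3 (∧-conicalʳ (face t) _ h)

  isEdge-⊆-face : ∀ {e t} → face t ≡ true → e ⊆ t → isEdge X e ≡ (∣ e ∣ ≡ᵇ 2)
  isEdge-⊆-face {e} {t} t∈X e⊆t rewrite downClosed e t e⊆t t∈X = refl

  within : Subset n → (Subset n → Bool) → Subset n → Bool
  within t P e = does (e ⊆? t) ∧ P e

  notIn : (Subset n → Bool) → Subset n → Bool
  notIn B e = isEdge X e ∧ not (B e)

  sizeB+sizeWminusB≡numEdges : ∀ B → sizeB X B + sizeWminusB X B ≡ numEdges X
  sizeB+sizeWminusB≡numEdges B = begin
    sizeB X B + sizeWminusB X B
      ≡⟨ cong₂ _+_ (countSubsets≡∑ (λ e → isEdge X e ∧ B e)) (countSubsets≡∑ (notIn B)) ⟩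
    ∑[ e ∈ W ] ⟦ isEdge X e ∧ B e ⟧ + ∑[ e ∈ W ] ⟦ notIn B e ⟧
      ≡⟨ ∑-distrib-+ W (λ e → ⟦ isEdge X e ∧ B e ⟧) (⟦_⟧ ∘ notIn B) ⟨
    ∑[ e ∈ W ] (⟦ isEdge X e ∧ B e ⟧ + ⟦ notIn B e ⟧)
      ≡⟨ ∑-cong W (λ e → ⟦∧⟧+⟦∧not⟧ (isEdge X e) (B e)) ⟩
    ∑[ e ∈ W ] ⟦ isEdge X e ⟧
      ≡⟨ countSubsets≡∑ (isEdge X) ⟨
    numEdges X ∎
    where
    open ≡-Reasoning
    W = allSubsets n

  edgesOfTriangle : ∀ {t} → isTriangle X t ≡ true → ∑[ e ∈ allSubsets n ] ⟦ within t (isEdge X) e ⟧ ≡ 3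
  edgesOfTriangle {t} t∈X₂ =
    trans (∑-cong (allSubsets n) as-between)
          (∑-between ⊥ t ⊥⊆ 3 2 (trans (isTriangle⇒∣t∣≡3 t∈X₂) (cong (3 +_) (sym (∣⊥∣≡0 n)))))
    where
    as-between : ∀ e → ⟦ within t (isEdge X) e ⟧ ≡ ⟦ between ⊥ t 2 e ⟧
    as-between e rewrite dec-true (⊥ ⊆? e) ⊥⊆ | ∣⊥∣≡0 n with e ⊆? t
    ... | no  _   = refl
    ... | yes e⊆t = cong ⟦_⟧ (isEdge-⊆-face (∧-conicalˡ (face t) _ t∈X₂) e⊆t)

  cutInTriangle≤2 : ∀ {t} → isTriangle X t ≡ true → ∀ B → B ⇒ᵇ isEdge X →
    ∑[ e ∈ allSubsets n ] ⟦ within t B e ⟧ * ∑[ f ∈ allSubsets n ] ⟦ within t (notIn B) f ⟧ ≤ 2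
  cutInTriangle≤2 {t} t∈X₂ B B⇒isEdge =
    m+n≡3⇒m*n≤2 (∑[ e ∈ W ] ⟦ within t B e ⟧) (∑[ e ∈ W ] ⟦ within t (notIn B) e ⟧) (begin
    ∑[ e ∈ W ] ⟦ within t B e ⟧ + ∑[ e ∈ W ] ⟦ within t (notIn B) e ⟧
      ≡⟨ ∑-distrib-+ W (⟦_⟧ ∘ within t B) (⟦_⟧ ∘ within t (notIn B)) ⟨
    ∑[ e ∈ W ] (⟦ within t B e ⟧ + ⟦ within t (notIn B) e ⟧)
      ≡⟨ ∑-cong W split ⟩
    ∑[ e ∈ W ] ⟦ within t (isEdge X) e ⟧
      ≡⟨ edgesOfTriangle t∈X₂ ⟩
    3 ∎)
    where
    open ≡-Reasoning
    W = allSubsets n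
    split : ∀ e → ⟦ within t B e ⟧ + ⟦ within t (notIn B) e ⟧ ≡ ⟦ within t (isEdge X) e ⟧
    split e with does (e ⊆? t) | B e in Be
    ... | false | _     = refl
    ... | true  | true  rewrite B⇒isEdge e Be = refl
    ... | true  | false = cong ⟦_⟧ (∧-identityʳ (isEdge X e))

  deg≡∑lookup : ∀ v → deg X v ≡ ∑[ e ∈ allSubsets n ] (⟦ isEdge X e ⟧ * ⟦ lookup e v ⟧)
  deg≡∑lookup v = trans (countSubsets≡∑ (λ e → isEdge X e ∧ ⌊ v ∈? e ⌋)) (∑-cong (allSubsets n) λ e →
    trans (cong (λ b → ⟦ isEdge X e ∧ b ⟧) (trans (isYes≗does (v ∈? e)) (does-∈?≡lookup v e)))
          (⟦∧⟧ (isEdge X e) (lookup e v)))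

  deg≤numEdges : ∀ v → deg X v ≤ numEdges X
  deg≤numEdges v =
    subst₂ _≤_ (sym (countSubsets≡∑ (λ e → isEdge X e ∧ ⌊ v ∈? e ⌋))) (sym (countSubsets≡∑ (isEdge X)))
      (∑-mono-≤ (allSubsets n) λ e → ⟦⟧-mono (∧-conicalˡ (isEdge X e) _))

  2≤deg : Pure2Dim X → ∀ v → 2 ≤ deg X v
  2≤deg pure v = begin
    2                                       ≡⟨ ∑-between ⁅ v ⁆ t v⊆t 2 1 ∣t∣≡2+1 ⟨
    ∑[ e ∈ W ] ⟦ between ⁅ v ⁆ t 1 e ⟧       ≤⟨ ∑-mono-≤ W (λ e → ⟦⟧-mono (incident e)) ⟩
    ∑[ e ∈ W ] ⟦ isEdge X e ∧ ⌊ v ∈? e ⌋ ⟧   ≡⟨ countSubsets≡∑ (λ e → isEdge X e ∧ ⌊ v ∈? e ⌋) ⟨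
    deg X v                                 ∎
    where
    open ≤-Reasoning
    open Pure2Dim pure
    W = allSubsets n
    t = proj₁ (inTriangle ⁅ v ⁆ (vertices v))
    t∈X₂ = proj₁ (proj₂ (inTriangle ⁅ v ⁆ (vertices v)))
    v⊆t = proj₂ (proj₂ (inTriangle ⁅ v ⁆ (vertices v)))
    ∣t∣≡2+1 : ∣ t ∣ ≡ 2 + ∣ ⁅ v ⁆ ∣
    ∣t∣≡2+1 = trans (isTriangle⇒∣t∣≡3 t∈X₂) (cong (2 +_) (sym (∣⁅x⁆∣≡1 v)))
    incident : ∀ e → between ⁅ v ⁆ t 1 e ≡ true → (isEdge X e ∧ ⌊ v ∈? e ⌋) ≡ true
    incident e h = cong₂ _∧_ e∈X₁ (trans (isYes≗does (v ∈? e)) (dec-true (v ∈? e) (v⊆e (x∈⁅x⁆ v))))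
      where
      e⊆t∧∣e∣≡2 = ∧-conicalʳ (does (⁅ v ⁆ ⊆? e)) _ h
      v⊆e = does-sound (⁅ v ⁆ ⊆? e) (∧-conicalˡ (does (⁅ v ⁆ ⊆? e)) _ h)
      e⊆t = does-sound (e ⊆? t) (∧-conicalˡ (does (e ⊆? t)) _ e⊆t∧∣e∣≡2)
      e∈X₁ : isEdge X e ≡ true
      e∈X₁ = trans (isEdge-⊆-face (∧-conicalˡ (face t) _ t∈X₂) e⊆t)
               (subst (λ j → (∣ e ∣ ≡ᵇ suc j) ≡ true) (∣⁅x⁆∣≡1 v)
                      (∧-conicalʳ (does (e ⊆? t)) _ e⊆t∧∣e∣≡2))

  deltaMin≤deg : ∀ v → deltaMin X ≤ deg X v
  deltaMin≤deg v =
    All.lookup (foldr-⊓-lower (numEdges X) (map (deg X) (allFin n))) (∈-map⁺ (deg X) (∈-allFin v))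

  2≤deltaMin : Pure2Dim X → Fin n → 2 ≤ deltaMin X
  2≤deltaMin pure v = foldr-⊓-greatest (numEdges X) (map (deg X) (allFin n))
    (≤-trans (2≤deg pure v) (deg≤numEdges v)) (All.map⁺ (All.tabulate⁺ (2≤deg pure)))

  ∑deg≡∑∣e∩U∣ : ∀ U → ∑[ v ∈ allFin n ] (⟦ lookup U v ⟧ * deg X v)
                    ≡ ∑[ e ∈ allSubsets n ] (⟦ isEdge X e ⟧ * ∣ e ∩ U ∣)
  ∑deg≡∑∣e∩U∣ U = begin
    ∑[ v ∈ V ] (⟦ lookup U v ⟧ * deg X v)
      ≡⟨ ∑-cong V (λ v → cong (⟦ lookup U v ⟧ *_) (deg≡∑lookup v)) ⟩
    ∑[ v ∈ V ] (⟦ lookup U v ⟧ * ∑[ e ∈ W ] (⟦ isEdge X e ⟧ * ⟦ lookup e v ⟧))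
      ≡⟨ ∑-cong V (λ v → ∑-distribˡ-* W ⟦ lookup U v ⟧ (λ e → ⟦ isEdge X e ⟧ * ⟦ lookup e v ⟧)) ⟨
    ∑[ v ∈ V ] ∑[ e ∈ W ] (⟦ lookup U v ⟧ * (⟦ isEdge X e ⟧ * ⟦ lookup e v ⟧))
      ≡⟨ ∑-comm V W _ ⟩
    ∑[ e ∈ W ] ∑[ v ∈ V ] (⟦ lookup U v ⟧ * (⟦ isEdge X e ⟧ * ⟦ lookup e v ⟧))
      ≡⟨ ∑-cong W (λ e → ∑-cong V (incidence e)) ⟩
    ∑[ e ∈ W ] ∑[ v ∈ V ] (⟦ isEdge X e ⟧ * ⟦ lookup (e ∩ U) v ⟧)
      ≡⟨ ∑-cong W (λ e → ∑-distribˡ-* V ⟦ isEdge X e ⟧ (λ v → ⟦ lookup (e ∩ U) v ⟧)) ⟩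
    ∑[ e ∈ W ] (⟦ isEdge X e ⟧ * ∑[ v ∈ V ] ⟦ lookup (e ∩ U) v ⟧)
      ≡⟨ ∑-cong W (λ e → cong (⟦ isEdge X e ⟧ *_) (∣p∣≡∑lookup (e ∩ U))) ⟨
    ∑[ e ∈ W ] (⟦ isEdge X e ⟧ * ∣ e ∩ U ∣) ∎
    where
    open ≡-Reasoning
    V = allFin n
    W = allSubsets n
    incidence : ∀ e v →
      ⟦ lookup U v ⟧ * (⟦ isEdge X e ⟧ * ⟦ lookup e v ⟧) ≡ ⟦ isEdge X e ⟧ * ⟦ lookup (e ∩ U) v ⟧
    incidence e v = begin
      ⟦ lookup U v ⟧ * (⟦ isEdge X e ⟧ * ⟦ lookup e v ⟧)
        ≡⟨ *-comm ⟦ lookup U v ⟧ _ ⟩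
      ⟦ isEdge X e ⟧ * ⟦ lookup e v ⟧ * ⟦ lookup U v ⟧
        ≡⟨ *-assoc ⟦ isEdge X e ⟧ _ _ ⟩
      ⟦ isEdge X e ⟧ * (⟦ lookup e v ⟧ * ⟦ lookup U v ⟧)
        ≡⟨ cong (⟦ isEdge X e ⟧ *_) (⟦∧⟧ (lookup e v) (lookup U v)) ⟨
      ⟦ isEdge X e ⟧ * ⟦ lookup e v ∧ lookup U v ⟧
        ≡⟨ cong (λ b → ⟦ isEdge X e ⟧ * ⟦ b ⟧) (lookup-zipWith _∧_ v e U) ⟨
      ⟦ isEdge X e ⟧ * ⟦ lookup (e ∩ U) v ⟧ ∎

  ∣U∣*deltaMin≤∑∣e∩U∣ : ∀ U → ∣ U ∣ * deltaMin X ≤ ∑[ e ∈ allSubsets n ] (⟦ isEdge X e ⟧ * ∣ e ∩ U ∣)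
  ∣U∣*deltaMin≤∑∣e∩U∣ U = begin
    ∣ U ∣ * δ                                     ≡⟨ cong (_* δ) (∣p∣≡∑lookup U) ⟩
    ∑[ v ∈ allFin n ] ⟦ lookup U v ⟧ * δ          ≡⟨ *-comm _ δ ⟩
    δ * ∑[ v ∈ allFin n ] ⟦ lookup U v ⟧          ≡⟨ ∑-distribˡ-* (allFin n) δ _ ⟨
    ∑[ v ∈ allFin n ] (δ * ⟦ lookup U v ⟧)        ≤⟨ ∑-mono-≤ (allFin n) δ≤deg ⟩
    ∑[ v ∈ allFin n ] (⟦ lookup U v ⟧ * deg X v)  ≡⟨ ∑deg≡∑∣e∩U∣ U ⟩
    ∑[ e ∈ allSubsets n ] (⟦ isEdge X e ⟧ * ∣ e ∩ U ∣) ∎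
    where
    open ≤-Reasoning
    δ = deltaMin X
    δ≤deg : ∀ v → δ * ⟦ lookup U v ⟧ ≤ ⟦ lookup U v ⟧ * deg X v
    δ≤deg v = subst (_≤ ⟦ lookup U v ⟧ * deg X v) (*-comm ⟦ lookup U v ⟧ δ)
                    (*-monoʳ-≤ ⟦ lookup U v ⟧ (deltaMin≤deg v))

  module _ (A : Subset n) where

    meets : ℕ → Subset n → Bool
    meets k e = isEdge X e ∧ (∣ e ∩ A ∣ ≡ᵇ k)

    edgesMeeting : ℕ → ℕ
    edgesMeeting k = ∑[ e ∈ allSubsets n ] ⟦ meets k e ⟧

    meets⇒∣e∩A∣≡ : ∀ {k e} → meets k e ≡ true → ∣ e ∩ A ∣ ≡ k
    meets⇒∣e∩A∣≡ {k} {e} h = true≡ᵇ⇒≡ ∣ e ∩ A ∣ k (∧-conicalʳ (isEdge X e) _ h)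

    edge-endpoints : ∀ e →
      (⟦ isEdge X e ⟧ * ∣ e ∩ A ∣ ≡ 2 * ⟦ meets 2 e ⟧ + ⟦ meets 1 e ⟧) ×
      (⟦ isEdge X e ⟧ * ∣ e ∩ ∁ A ∣ ≡ 2 * ⟦ meets 0 e ⟧ + ⟦ meets 1 e ⟧) ×
      (⟦ isEdge X e ⟧ ≡ ⟦ meets 2 e ⟧ + ⟦ meets 1 e ⟧ + ⟦ meets 0 e ⟧)
    edge-endpoints e with isEdge X e in e∈X₁
    ... | false = refl , refl , refl
    ... | true  = a+c≡2⇒indicators ∣ e ∩ A ∣ ∣ e ∩ ∁ A ∣
                    (trans (∣p∩q∣+∣p∩∁q∣≡∣p∣ e A) (isEdge⇒∣e∣≡2 e∈X₁))

    numEdges≡e₂+e₁+e₀ : numEdges X ≡ edgesMeeting 2 + edgesMeeting 1 + edgesMeeting 0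
    numEdges≡e₂+e₁+e₀ = begin
      numEdges X
        ≡⟨ countSubsets≡∑ (isEdge X) ⟩
      ∑[ e ∈ W ] ⟦ isEdge X e ⟧
        ≡⟨ ∑-cong W (proj₂ ∘ proj₂ ∘ edge-endpoints) ⟩
      ∑[ e ∈ W ] (⟦ meets 2 e ⟧ + ⟦ meets 1 e ⟧ + ⟦ meets 0 e ⟧)
        ≡⟨ ∑-distrib-+ W (λ e → ⟦ meets 2 e ⟧ + ⟦ meets 1 e ⟧) (⟦_⟧ ∘ meets 0) ⟩
      ∑[ e ∈ W ] (⟦ meets 2 e ⟧ + ⟦ meets 1 e ⟧) + edgesMeeting 0
        ≡⟨ cong (_+ edgesMeeting 0) (∑-distrib-+ W (⟦_⟧ ∘ meets 2) (⟦_⟧ ∘ meets 1)) ⟩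
      edgesMeeting 2 + edgesMeeting 1 + edgesMeeting 0 ∎
      where
      open ≡-Reasoning
      W = allSubsets n

    2*[∣A∣∸e₂]≤e₁ : Pure2Dim X → Fin n → 2 * (∣ A ∣ ∸ edgesMeeting 2) ≤ edgesMeeting 1
    2*[∣A∣∸e₂]≤e₁ pure v = 2*[m∸n]≤o ∣ A ∣ (edgesMeeting 2) (edgesMeeting 1) (begin
      2 * ∣ A ∣                                             ≡⟨ *-comm 2 ∣ A ∣ ⟩
      ∣ A ∣ * 2                                             ≤⟨ *-monoʳ-≤ ∣ A ∣ (2≤deltaMin pure v) ⟩
      ∣ A ∣ * deltaMin X                                    ≤⟨ ∣U∣*deltaMin≤∑∣e∩U∣ A ⟩
      ∑[ e ∈ allSubsets n ] (⟦ isEdge X e ⟧ * ∣ e ∩ A ∣)   ≡⟨ ∑-2*+ (allSubsets n) (proj₁ ∘ edge-endpoints) ⟩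
      2 * edgesMeeting 2 + edgesMeeting 1                   ∎)
      where open ≤-Reasoning

    ∣∁A∣*deltaMin≤2*e₀+e₁ : ∣ ∁ A ∣ * deltaMin X ≤ 2 * edgesMeeting 0 + edgesMeeting 1
    ∣∁A∣*deltaMin≤2*e₀+e₁ =
      subst (∣ ∁ A ∣ * deltaMin X ≤_) (∑-2*+ (allSubsets n) (proj₁ ∘ proj₂ ∘ edge-endpoints))
        (∣U∣*deltaMin≤∑∣e∩U∣ (∁ A))

    crossing : Subset n → Bool
    crossing t = isTriangle X t ∧ ⌊ nonempty? (t ∩ A) ⌋ ∧ ⌊ nonempty? (t ∩ ∁ A) ⌋

    module _ (B : Subset n → Bool) (B⇒isEdge : B ⇒ᵇ isEdge X)
             (B-meets-A : ∀ e → B e ≡ true → Nonempty (e ∩ A))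
             (nonB-meets-∁A : ∀ f → isEdge X f ≡ true → B f ≡ false → Nonempty (f ∩ ∁ A)) where

      private
        cut : Subset n → Subset n → Bool
        cut e f = adjacent X e f ∧ B e ∧ not (B f)

        cutVia : Subset n → Subset n → Subset n → ℕ
        cutVia e f t = ⟦ crossing t ⟧ * (⟦ within t B e ⟧ * ⟦ within t (notIn B) f ⟧)

        cut≤∑cutVia : ∀ e f → ⟦ cut e f ⟧ ≤ ∑[ t ∈ allSubsets n ] cutVia e f t
        cut≤∑cutVia e f with cut e f in cut≡true
        ... | false = z≤n
        ... | true  = any⇒1≤∑ (allSubsets n) (λ t → isTriangle X t ∧ ⌊ e ⊆? t ⌋ ∧ ⌊ f ⊆? t ⌋) (cutVia e f)
                        inCommonTriangle counted
          where
          adj = ∧-conicalˡ (adjacent X e f) _ cut≡true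
          Be  = ∧-conicalˡ (B e) _ (∧-conicalʳ (adjacent X e f) _ cut≡true)
          ¬Bf = ∧-conicalʳ (B e) _ (∧-conicalʳ (adjacent X e f) _ cut≡true)
          f∈X₁ = ∧-conicalˡ (isEdge X f) _ (∧-conicalʳ (isEdge X e) _ adj)
          inCommonTriangle = ∧-conicalʳ _ _ (∧-conicalʳ (isEdge X f) _ (∧-conicalʳ (isEdge X e) _ adj))
          counted : ∀ t → (isTriangle X t ∧ ⌊ e ⊆? t ⌋ ∧ ⌊ f ⊆? t ⌋) ≡ true → 1 ≤ cutVia e f t
          counted t h = ≤-reflexive (sym (cong₂ (λ c b → ⟦ c ⟧ * b)
                          (cong₂ _∧_ t∈X₂ (cong₂ _∧_ meetsA meets∁A))
                          (cong₂ (λ i o → ⟦ i ⟧ * ⟦ o ⟧) (cong₂ _∧_ e⊆t Be)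
                                 (cong₂ _∧_ f⊆t (cong₂ _∧_ f∈X₁ ¬Bf)))))
            where
            t∈X₂ = ∧-conicalˡ (isTriangle X t) _ h
            e⊆t = isYes⇒does (e ⊆? t) (∧-conicalˡ ⌊ e ⊆? t ⌋ _ (∧-conicalʳ (isTriangle X t) _ h))
            f⊆t = isYes⇒does (f ⊆? t) (∧-conicalʳ ⌊ e ⊆? t ⌋ _ (∧-conicalʳ (isTriangle X t) _ h))
            Bf≡false = trans (sym (not-involutive (B f))) (cong not ¬Bf)
            meetsA : ⌊ nonempty? (t ∩ A) ⌋ ≡ true
            meetsA = trans (isYes≗does _) (dec-true (nonempty? (t ∩ A))
                       (Nonempty-∩-⊆ A (does-sound (e ⊆? t) e⊆t) (B-meets-A e Be)))
            meets∁A : ⌊ nonempty? (t ∩ ∁ A) ⌋ ≡ true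
            meets∁A = trans (isYes≗does _) (dec-true (nonempty? (t ∩ ∁ A))
                        (Nonempty-∩-⊆ (∁ A) (does-sound (f ⊆? t) f⊆t) (nonB-meets-∁A f f∈X₁ Bf≡false)))

        ∑cutVia≤2 : ∀ t → ∑[ e ∈ allSubsets n ] ∑[ f ∈ allSubsets n ] cutVia e f t ≤ 2 * ⟦ crossing t ⟧
        ∑cutVia≤2 t with crossing t in crossing≡true
        ... | false = ≤-reflexive (trans (∑-cong W (λ _ → ∑-zero W)) (∑-zero W))
          where W = allSubsets n
        ... | true  = begin
          ∑[ e ∈ W ] ∑[ f ∈ W ] (1 * (⟦ within t B e ⟧ * ⟦ within t (notIn B) f ⟧))
            ≡⟨ ∑-cong W (λ e → ∑-cong W (λ f → *-identityˡ _)) ⟩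
          ∑[ e ∈ W ] ∑[ f ∈ W ] (⟦ within t B e ⟧ * ⟦ within t (notIn B) f ⟧)
            ≡⟨ ∑*∑ W (⟦_⟧ ∘ within t B) (⟦_⟧ ∘ within t (notIn B)) ⟩
          ∑[ e ∈ W ] ⟦ within t B e ⟧ * ∑[ f ∈ W ] ⟦ within t (notIn B) f ⟧
            ≤⟨ cutInTriangle≤2 (∧-conicalˡ (isTriangle X t) _ crossing≡true) B B⇒isEdge ⟩
          2 ∎
          where
          open ≤-Reasoning
          W = allSubsets n

      crossE≤2*crossF : crossE X B ≤ 2 * crossF X A
      crossE≤2*crossF = begin
        crossE X B                                         ≡⟨ countPairs≡∑∑ cut ⟩
        ∑[ e ∈ W ] ∑[ f ∈ W ] ⟦ cut e f ⟧                   ≤⟨ ∑-mono-≤ W (λ e → ∑-mono-≤ W (cut≤∑cutVia e)) ⟩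
        ∑[ e ∈ W ] ∑[ f ∈ W ] ∑[ t ∈ W ] cutVia e f t       ≡⟨ ∑-cong W (λ e → ∑-comm W W (cutVia e)) ⟩
        ∑[ e ∈ W ] ∑[ t ∈ W ] ∑[ f ∈ W ] cutVia e f t       ≡⟨ ∑-comm W W (λ e t → ∑[ f ∈ W ] cutVia e f t) ⟩
        ∑[ t ∈ W ] ∑[ e ∈ W ] ∑[ f ∈ W ] cutVia e f t       ≤⟨ ∑-mono-≤ W ∑cutVia≤2 ⟩
        ∑[ t ∈ W ] (2 * ⟦ crossing t ⟧)                     ≡⟨ ∑-distribˡ-* W 2 (⟦_⟧ ∘ crossing) ⟩
        2 * ∑[ t ∈ W ] ⟦ crossing t ⟧                       ≡⟨ cong (2 *_) (countSubsets≡∑ crossing) ⟨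
        2 * crossF X A                                     ∎
        where
        open ≤-Reasoning
        W = allSubsets n

    module InsideEdges∪ (S : Subset n → Bool) (S⇒meets₁ : S ⇒ᵇ meets 1) where

      B : Subset n → Bool
      B e = meets 2 e ∨ S e

      private
        meets₂⇒¬S : ∀ e → meets 2 e ≡ true → S e ≡ false
        meets₂⇒¬S e m₂ with S e in Se
        ... | false = refl
        ... | true  = contradiction (trans (sym (meets⇒∣e∩A∣≡ m₂)) (meets⇒∣e∩A∣≡ (S⇒meets₁ e Se))) λ ()

      B⇒isEdge : B ⇒ᵇ isEdge X
      B⇒isEdge e h with meets 2 e in m₂
      ... | true  = ∧-conicalˡ (isEdge X e) _ m₂
      ... | false = ∧-conicalˡ (isEdge X e) _ (S⇒meets₁ e h)

      B-meets-A : ∀ e → B e ≡ true → Nonempty (e ∩ A)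
      B-meets-A e h = 0<∣p∣⇒Nonempty (0<∣e∩A∣ h)
        where
        0<∣e∩A∣ : B e ≡ true → 0 < ∣ e ∩ A ∣
        0<∣e∩A∣ h with meets 2 e in m₂
        ... | true  = subst (0 <_) (sym (meets⇒∣e∩A∣≡ m₂)) z<s
        ... | false = subst (0 <_) (sym (meets⇒∣e∩A∣≡ (S⇒meets₁ e h))) z<s

      nonB-meets-∁A : ∀ f → isEdge X f ≡ true → B f ≡ false → Nonempty (f ∩ ∁ A)
      nonB-meets-∁A f f∈X₁ h = 0<∣p∣⇒Nonempty (n≢0⇒n>0 λ ∣f∩∁A∣≡0 → ∣f∩A∣≢2 (begin
        ∣ f ∩ A ∣                 ≡⟨ +-identityʳ _ ⟨
        ∣ f ∩ A ∣ + 0             ≡⟨ cong (∣ f ∩ A ∣ +_) ∣f∩∁A∣≡0 ⟨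
        ∣ f ∩ A ∣ + ∣ f ∩ ∁ A ∣   ≡⟨ ∣p∩q∣+∣p∩∁q∣≡∣p∣ f A ⟩
        ∣ f ∣                     ≡⟨ isEdge⇒∣e∣≡2 f∈X₁ ⟩
        2                         ∎))
        where
        open ≡-Reasoning
        ∣f∩A∣≢2 : ∣ f ∩ A ∣ ≢ 2
        ∣f∩A∣≢2 = false≡ᵇ⇒≢
          (subst (λ b → b ∧ (∣ f ∩ A ∣ ≡ᵇ 2) ≡ false) f∈X₁ (∨-conicalˡ (meets 2 f) _ h))

      sizeB≡e₂+∣S∣ : sizeB X B ≡ edgesMeeting 2 + ∑[ e ∈ allSubsets n ] ⟦ S e ⟧
      sizeB≡e₂+∣S∣ = begin
        sizeB X B                           ≡⟨ countSubsets≡∑ (λ e → isEdge X e ∧ B e) ⟩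
        ∑[ e ∈ W ] ⟦ isEdge X e ∧ B e ⟧     ≡⟨ ∑-cong W (λ e → ⟦∧⟧-⇒ (isEdge X e) (B e) (B⇒isEdge e)) ⟩
        ∑[ e ∈ W ] ⟦ meets 2 e ∨ S e ⟧      ≡⟨ ∑-cong W (λ e → ⟦∨⟧ (meets 2 e) (S e) (meets₂⇒¬S e)) ⟩
        ∑[ e ∈ W ] (⟦ meets 2 e ⟧ + ⟦ S e ⟧) ≡⟨ ∑-distrib-+ W (⟦_⟧ ∘ meets 2) (⟦_⟧ ∘ S) ⟩
        edgesMeeting 2 + ∑[ e ∈ W ] ⟦ S e ⟧ ∎
        where
        open ≡-Reasoning
        W = allSubsets n

      ∣S∣+sizeWminusB≡e₁+e₀ : ∑[ e ∈ allSubsets n ] ⟦ S e ⟧ + sizeWminusB X B ≡ edgesMeeting 1 + edgesMeeting 0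
      ∣S∣+sizeWminusB≡e₁+e₀ = +-cancelˡ-≡ e₂ _ _ (begin
        e₂ + (∣S∣ + sizeWminusB X B)   ≡⟨ +-assoc e₂ ∣S∣ _ ⟨
        e₂ + ∣S∣ + sizeWminusB X B     ≡⟨ cong (_+ sizeWminusB X B) sizeB≡e₂+∣S∣ ⟨
        sizeB X B + sizeWminusB X B    ≡⟨ sizeB+sizeWminusB≡numEdges B ⟩
        numEdges X                     ≡⟨ numEdges≡e₂+e₁+e₀ ⟩
        e₂ + edgesMeeting 1 + edgesMeeting 0   ≡⟨ +-assoc e₂ _ _ ⟩
        e₂ + (edgesMeeting 1 + edgesMeeting 0) ∎)
        where
        open ≡-Reasoning
        e₂ = edgesMeeting 2
        ∣S∣ = ∑[ e ∈ allSubsets n ] ⟦ S e ⟧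

lemma3p2 : (n : ℕ) (X : SimplicialComplex n) → Pure2Dim X → Connected X →
    (A : Subset n) → 0 < ∣ A ∣ → ∣ A ∣ < n →
    ((A′ : Subset n) → 0 < ∣ A′ ∣ → ∣ A′ ∣ < n →
      n * crossF X A * (∣ A′ ∣ * ∣ ∁ A′ ∣) ≤ n * crossF X A′ * (∣ A ∣ * ∣ ∁ A ∣)) →
    Σ (Subset n → Bool) (λ B →
      ((s : Subset n) → B s ≡ true → isEdge X s ≡ true) ×
      0 < sizeB X B × sizeB X B < numEdges X ×
      crossE X B ≤ 2 * crossF X A ×
      ∣ A ∣ ≤ sizeB X B ×
      ∣ ∁ A ∣ * deltaMin X ≤ 2 * sizeWminusB X B)
lemma3p2 n X pure _ A 0<∣A∣ ∣A∣<n _ =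
  B , B⇒isEdge , ≤-trans 0<∣A∣ ∣A∣≤∣B∣ , ∣B∣<∣W∣ ,
  crossE≤2*crossF X A B B⇒isEdge B-meets-A nonB-meets-∁A , ∣A∣≤∣B∣ , ∣∁A∣δ≤2∣W∖B∣
  where
  v = proj₁ (0<∣p∣⇒Nonempty {p = A} 0<∣A∣)
  s = ∣ A ∣ ∸ edgesMeeting X A 2
  2s≤e₁ = 2*[∣A∣∸e₂]≤e₁ X A pure v
  chosen = choose n (meets X A 1) s (≤-trans (m≤m+n s (s + 0)) 2s≤e₁)
  ∣S∣≡s = proj₂ (proj₂ chosen)
  open InsideEdges∪ X A (proj₁ chosen) (proj₁ (proj₂ chosen))
  ∣A∣≤∣B∣ = subst (∣ A ∣ ≤_) (sym (trans sizeB≡e₂+∣S∣ (cong (edgesMeeting X A 2 +_) ∣S∣≡s)))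
                  (m≤n+m∸n ∣ A ∣ (edgesMeeting X A 2))
  ∣∁A∣δ≤2∣W∖B∣ = ≤-trans (∣∁A∣*deltaMin≤2*e₀+e₁ X A)
    (2*s≤c⇒2*d+c≤2*w s _ _ _ 2s≤e₁ (subst (λ k → k + sizeWminusB X B ≡ _) ∣S∣≡s ∣S∣+sizeWminusB≡e₁+e₀))
  0<∣∁A∣ = subst (0 <_) (sym (∣∁p∣≡n∸∣p∣ A)) (m<n⇒0<n∸m ∣A∣<n)
  2≤2∣W∖B∣ = ≤-trans (*-mono-≤ 0<∣∁A∣ (2≤deltaMin X pure v)) ∣∁A∣δ≤2∣W∖B∣
  ∣B∣<∣W∣ = subst (sizeB X B <_) (sizeB+sizeWminusB≡numEdges X B)
                  (m<m+n (sizeB X B) (*-cancelˡ-< 2 0 _ (≤-trans (s≤s z≤n) 2≤2∣W∖B∣)))
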